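{- For the triangle solitaire on $\mathbb{Z}^2$: (i) for every $m$ there exists a finite pattern $P$ with $e(P)\ge m$ whose only excess set is $\varnothing$ (so its phantom excess is at least $m$); (ii) for every $m$ there exist finite patterns $P,Q$ in the same solitaire orbit with $\hat E(Q)-\hat E(P)\ge m$; (iii) there exists a finite pattern having two excess sets that are both maximal with respect to inclusion among excess sets but have different cardinalities.
   Context: $T=\{(0,0),(1,0),(0,1)\}$. A triangle solitaire move is a pair $(P,Q)$ with $|P\cap(\vec v+T)|=|Q\cap(\vec v+T)|=2$ and $P\triangle Q$ a $2$-element subset of $\vec v+T$ for some $\vec v\in\mathbb{Z}^2$; orbits are equivalence classes under the reflexive-transitive closure. $\varphi(P)$ is the filling closure obtained by repeatedly adding the missing point of any $\vec v+T$ with $|P\cap(\vec v+T)|=2$. For finite $P$: the excess is $e(P)=|P|-\min\{|R|:\varphi(R)=\varphi(P)\}$; an excess set of $P$ is $Q\subset P$ with $\varphi(P\setminus Q)=\varphi(P)$; the visible excess $\hat E(P)$ is the maximal cardinality of an excess set; the phantom excess is $e(P)-\hat E(P)$. -}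

module Defs where

open import Data.Nat using (ℕ; _≤_; _∸_; _+_)
open import Data.Integer using (ℤ; _+_; +_)
open import Data.Integer.Properties using () renaming (_≟_ to _≟ℤ_)
open import Data.Product using (Σ; _×_; _,_; ∃; ∃-syntax)
open import Data.Product.Properties using (≡-dec)
open import Data.Sum using (_⊎_)
open import Data.List using (List; []; _∷_; length; filter)
open import Data.List.Relation.Unary.All using (All)
open import Data.List.Relation.Unary.Unique.Propositional using (Unique)
open import Relation.Binary.PropositionalEquality using (_≡_; _≢_)
open import Relation.Binary.Construct.Closure.ReflexiveTransitive using (Star)
open import Relation.Binary using (DecidableEquality)
open import Relation.Nullary using (¬_)
open import Function.Bundles using (_⇔_)

Point : Set
Point = ℤ × ℤ

_≟P_ : DecidableEquality Point
_≟P_ = ≡-dec _≟ℤ_ _≟ℤ_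

open import Data.List.Membership.DecPropositional _≟P_ public
  using (_∈_; _∉_; _∈?_)

_⊕_ : Point → Point → Point
(a , b) ⊕ (c , d) = (a Data.Integer.+ c , b Data.Integer.+ d)

corner₀ corner₁ corner₂ : Point → Point
corner₀ v = v ⊕ (+ 0 , + 0)
corner₁ v = v ⊕ (+ 1 , + 0)
corner₂ v = v ⊕ (+ 0 , + 1)

InTri : Point → Point → Set
InTri v x = (x ≡ corner₀ v) ⊎ (x ≡ corner₁ v) ⊎ (x ≡ corner₂ v)

corners : Point → List Point
corners v = corner₀ v ∷ corner₁ v ∷ corner₂ v ∷ []

-- A finite pattern: a duplicate-free list of points (read as a finite set).
-- Its cardinality is its length.
FinPattern : List Point → Set
FinPattern P = Unique P

countIn : List Point → Point → ℕ
countIn P v = length (filter (_∈? P) (corners v))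

SymDiff : List Point → List Point → Point → Set
SymDiff P Q x = (x ∈ P × x ∉ Q) ⊎ (x ∈ Q × x ∉ P)

Move : List Point → List Point → Set
Move P Q = ∃[ v ] (countIn P v ≡ 2 × countIn Q v ≡ 2 ×
  (∃[ a ] ∃[ b ] (a ≢ b × InTri v a × InTri v b ×
     (∀ x → SymDiff P Q x ⇔ (x ≡ a ⊎ x ≡ b)))))

SameOrbit : List Point → List Point → Set
SameOrbit = Star Move

data Fill (S : Point → Set) : Point → Set where
  base  : ∀ {x} → S x → Fill S x
  fill₀ : ∀ v → Fill S (corner₁ v) → Fill S (corner₂ v) → Fill S (corner₀ v)
  fill₁ : ∀ v → Fill S (corner₀ v) → Fill S (corner₂ v) → Fill S (corner₁ v)
  fill₂ : ∀ v → Fill S (corner₀ v) → Fill S (corner₁ v) → Fill S (corner₂ v)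

SameFill : (Point → Set) → (Point → Set) → Set
SameFill S S' = ∀ x → Fill S x ⇔ Fill S' x

⟦_⟧ : List Point → Point → Set
⟦ P ⟧ x = x ∈ P

IsMinGenSize : List Point → ℕ → Set
IsMinGenSize P k =
  (∃[ R ] (FinPattern R × length R ≡ k × SameFill ⟦ R ⟧ ⟦ P ⟧)) ×
  (∀ R → FinPattern R → SameFill ⟦ R ⟧ ⟦ P ⟧ → k ≤ length R)

IsExcess : List Point → ℕ → Set
IsExcess P e = ∃[ k ] (IsMinGenSize P k × e ≡ length P ∸ k)

_∖_ : List Point → List Point → Point → Set
(P ∖ Q) x = x ∈ P × x ∉ Q

ExcessSet : List Point → List Point → Set
ExcessSet P Q = FinPattern Q × All (_∈ P) Q × SameFill (P ∖ Q) ⟦ P ⟧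

IsVisibleExcess : List Point → ℕ → Set
IsVisibleExcess P k =
  (∃[ Q ] (ExcessSet P Q × length Q ≡ k)) ×
  (∀ Q → ExcessSet P Q → length Q ≤ k)

MaximalExcessSet : List Point → List Point → Set
MaximalExcessSet P Q = ExcessSet P Q ×
  (∀ Q' → ExcessSet P Q' → (∀ x → x ∈ Q → x ∈ Q') → (∀ x → x ∈ Q' → x ∈ Q))

-- The map (x , y) ↦ tˣ (1 + t)ʸ into 𝔽₂[t]/(t⁷) sends the corners of every triangle to
-- vectors summing to zero and the bottom row of Δ₇ = {x , y ≥ 0 , x + y ≤ 6} to a basis, so
-- every set filling Δ₇ has at least seven points.  The eight points of G fill Δ₇, yet none of
-- them can be dropped: excess one, but no nonempty excess set.  Copies ten columns apart never
-- share a triangle, so m copies of G have excess m and still no excess set.  One move turns G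
-- into H, from which (0 , 6) can be dropped; m copies of H lie in the orbit of m copies of G and
-- have visible excess m.  Finally G with (1 , 0) added has the maximal excess sets {(1 , 0)}
-- and {(0 , 0) , (0 , 1)}.  All facts about the finitely many points involved are checked by
-- computation.

module Submission where

open import Defs
open import Data.Nat using (ℕ; _≤_; _+_)
open import Data.Product using (_×_; ∃-syntax)
open import Data.List using (List; []; length)
open import Relation.Binary.PropositionalEquality using (_≡_; _≢_)

open import Level using (0ℓ)
open import Function using (_∘_; case_of_)
open import Function.Bundles using (_⇔_; mk⇔; Equivalence)
open import Data.Empty using (⊥; ⊥-elim)
open import Data.Bool using (Bool; true; false; _xor_; if_then_else_)
import Data.Bool.Properties as Bool
open import Data.Sum using (_⊎_; inj₁; inj₂)
import Data.Sum as Sum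
open import Data.Product as Product using (_,_; proj₁; proj₂)
open import Data.Nat as ℕ using (zero; suc; _*_; _∸_; _^_; z≤n; s≤s)
import Data.Nat.Properties as ℕ
open import Data.Nat.GeneralisedArithmetic using (iterate)
open import Data.Integer as ℤ using (ℤ; +_)
import Data.Integer.Properties as ℤ
open import Data.Fin using (Fin; toℕ)
import Data.Fin.Properties as Fin
open import Data.Vec as V using (Vec; []; _∷_)
import Data.Vec.Properties as V
open import Data.List using (_∷_; _++_; map; filter; concatMap; deduplicate; upTo)
open import Data.List.Properties using (length-++; length-map)
open import Data.List.Relation.Unary.Any as Any using (Any; here; there)
open import Data.List.Relation.Unary.All as All using (All; all?; []; _∷_)
open import Data.List.Relation.Unary.AllPairs using ([]; _∷_)
open import Data.List.Relation.Unary.Unique.Propositional using (Unique)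
import Data.List.Relation.Unary.Unique.Propositional.Properties as Unique
open import Data.List.Relation.Unary.Unique.DecPropositional _≟P_ using (unique?)
open import Data.List.Relation.Binary.Pointwise using (Pointwise; []; _∷_)
open import Data.List.Membership.Propositional using (find) renaming (_∈_ to _∈ₗ_)
open import Data.List.Membership.Propositional.Properties
  using (∈-++⁺ˡ; ∈-++⁺ʳ; ∈-++⁻; ∈-map⁺; ∈-map⁻; ∈-filter⁺; ∈-filter⁻;
         ∈-concatMap⁻; ∈-deduplicate⁻)
open import Relation.Binary.PropositionalEquality
  using (refl; sym; trans; cong; cong₂; subst; subst₂; module ≡-Reasoning)
open import Relation.Binary.Construct.Closure.ReflexiveTransitive
  using (Star; ε; _◅_; _◅◅_; gmap)
import Relation.Binary.Construct.Closure.ReflexiveTransitive as Star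
open import Relation.Nullary using (¬_; Dec; does; yes; no; ¬?)
open import Relation.Nullary.Decidable using (_×-dec_; _→-dec_; from-yes; from-no)
open import Relation.Unary using (Pred; Decidable; _⊆_; _∩_; _∪_)
import Algebra
open import Algebra.Properties.CommutativeSemigroup ℤ.+-commutativeSemigroup
  using (xy∙z≈xz∙y)
open import Algebra.Properties.CommutativeSemigroup
  (Algebra.CommutativeRing.+-commutativeSemigroup Bool.xor-∧-commutativeRing)
  using () renaming (interchange to xor-interchange)
open Equivalence using (to; from)

length-─ : ∀ {A : Set} {x : A} xs (x∈ : x ∈ₗ xs) → length xs ≡ suc (length (xs Any.─ x∈))
length-─ (_ ∷ _)  (here _)   = refl
length-─ (_ ∷ xs) (there x∈) = cong suc (length-─ xs x∈)

∈-─ : ∀ {A : Set} {x z : A} xs (x∈ : x ∈ₗ xs) → z ∈ₗ xs → z ≢ x → z ∈ₗ (xs Any.─ x∈)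
∈-─ (_ ∷ _)  (here refl) (here refl) z≢x = ⊥-elim (z≢x refl)
∈-─ (_ ∷ _)  (here _)    (there z∈)  _   = z∈
∈-─ (_ ∷ _)  (there _)   (here refl) _   = here refl
∈-─ (_ ∷ xs) (there x∈)  (there z∈)  z≢x = there (∈-─ xs x∈ z∈ z≢x)

unique-⊆⇒length-≤ : ∀ {A : Set} {xs ys : List A} → Unique xs →
                    (∀ {z} → z ∈ₗ xs → z ∈ₗ ys) → length xs ≤ length ys
unique-⊆⇒length-≤ {xs = []}     _             _    = z≤n
unique-⊆⇒length-≤ {xs = x ∷ xs} {ys} (x∉xs ∷ u) xs⊆ys =
  subst (suc (length xs) ≤_) (sym (length-─ ys x∈ys))
    (s≤s (unique-⊆⇒length-≤ u λ z∈ → ∈-─ ys x∈ys (xs⊆ys (there z∈)) (All.lookup x∉xs z∈ ∘ sym)))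
  where
  x∈ys : x ∈ₗ ys
  x∈ys = xs⊆ys (here refl)

length-filter-¬ : ∀ {A : Set} {P : Pred A 0ℓ} (P? : Decidable P) xs →
                  length (filter P? xs) + length (filter (λ x → ¬? (P? x)) xs) ≡ length xs
length-filter-¬ P? []       = refl
length-filter-¬ P? (x ∷ xs) with does (P? x)
... | true  = cong suc (length-filter-¬ P? xs)
... | false = trans (ℕ.+-suc _ _) (cong suc (length-filter-¬ P? xs))

-- Linear algebra over 𝔽₂

Bits : ℕ → Set
Bits = Vec Bool

infixl 6 _+ᵇ_
_+ᵇ_ : ∀ {n} → Bits n → Bits n → Bits n
_+ᵇ_ = V.zipWith _xor_

0ᵇ : ∀ {n} → Bits n
0ᵇ = V.replicate _ false

+ᵇ-identityˡ : ∀ {n} (u : Bits n) → 0ᵇ +ᵇ u ≡ u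
+ᵇ-identityˡ = V.zipWith-identityˡ Bool.xor-identityˡ

+ᵇ-identityʳ : ∀ {n} (u : Bits n) → u +ᵇ 0ᵇ ≡ u
+ᵇ-identityʳ = V.zipWith-identityʳ Bool.xor-identityʳ

+ᵇ-self : ∀ {n} (u : Bits n) → u +ᵇ u ≡ 0ᵇ
+ᵇ-self []      = refl
+ᵇ-self (b ∷ u) = cong₂ _∷_ (Bool.xor-same b) (+ᵇ-self u)

+ᵇ-interchange : ∀ {n} (a b c d : Bits n) → (a +ᵇ b) +ᵇ (c +ᵇ d) ≡ (a +ᵇ c) +ᵇ (b +ᵇ d)
+ᵇ-interchange []       []       []       []       = refl
+ᵇ-interchange (a ∷ as) (b ∷ bs) (c ∷ cs) (d ∷ ds) =
  cong₂ _∷_ (xor-interchange a b c d) (+ᵇ-interchange as bs cs ds)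

select : ∀ {n} → Bool → Bits n → Bits n
select b w = if b then w else 0ᵇ

select-xor : ∀ {n} b c (w : Bits n) → select (b xor c) w ≡ select b w +ᵇ select c w
select-xor true  true  w = sym (+ᵇ-self w)
select-xor true  false w = sym (+ᵇ-identityʳ w)
select-xor false c     w = sym (+ᵇ-identityˡ (select c w))

lincomb : ∀ {n k} → Vec (Bits n) k → Bits k → Bits n
lincomb []       []      = 0ᵇ
lincomb (w ∷ ws) (b ∷ s) = select b w +ᵇ lincomb ws s

lincomb-0 : ∀ {n k} (ws : Vec (Bits n) k) → lincomb ws 0ᵇ ≡ 0ᵇ
lincomb-0 []       = refl
lincomb-0 (w ∷ ws) = trans (+ᵇ-identityˡ _) (lincomb-0 ws)

lincomb-+ : ∀ {n k} (ws : Vec (Bits n) k) s t → lincomb ws (s +ᵇ t) ≡ lincomb ws s +ᵇ lincomb ws t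
lincomb-+ []       []      []      = sym (+ᵇ-identityˡ 0ᵇ)
lincomb-+ (w ∷ ws) (b ∷ s) (c ∷ t) =
  trans (cong₂ _+ᵇ_ (select-xor b c w) (lincomb-+ ws s t)) (+ᵇ-interchange _ _ _ _)

Span : ∀ {n k} → Vec (Bits n) k → Pred (Bits n) 0ℓ
Span ws u = ∃[ s ] (lincomb ws s ≡ u)

Span-0 : ∀ {n k} (ws : Vec (Bits n) k) → Span ws 0ᵇ
Span-0 ws = 0ᵇ , lincomb-0 ws

Span-+ : ∀ {n k} {ws : Vec (Bits n) k} {u w} → Span ws u → Span ws w → Span ws (u +ᵇ w)
Span-+ {ws = ws} (s , refl) (t , refl) = s +ᵇ t , lincomb-+ ws s t

Span-lincomb : ∀ {n k j} (ws : Vec (Bits n) k) (us : Vec (Bits n) j) →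
               (∀ i → Span ws (V.lookup us i)) → ∀ t → Span ws (lincomb us t)
Span-lincomb ws []       _     []      = Span-0 ws
Span-lincomb ws (u ∷ us) us∈ws (b ∷ t) =
  Span-+ {ws = ws} (Span-select b) (Span-lincomb ws us (us∈ws ∘ Fin.suc) t)
  where
  Span-select : ∀ b → Span ws (select b u)
  Span-select true  = us∈ws Fin.zero
  Span-select false = Span-0 ws

units : ∀ n → Vec (Bits n) n
units zero    = []
units (suc n) = (true ∷ 0ᵇ) ∷ V.map (false ∷_) (units n)

lincomb-false∷ : ∀ {n k} (ws : Vec (Bits n) k) s → lincomb (V.map (false ∷_) ws) s ≡ false ∷ lincomb ws s
lincomb-false∷ []       []         = refl
lincomb-false∷ (w ∷ ws) (true ∷ s)  = cong ((false ∷ w) +ᵇ_) (lincomb-false∷ ws s)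
lincomb-false∷ (w ∷ ws) (false ∷ s) = cong (0ᵇ +ᵇ_) (lincomb-false∷ ws s)

lincomb-units : ∀ n (t : Bits n) → lincomb (units n) t ≡ t
lincomb-units zero    []      = refl
lincomb-units (suc n) (b ∷ t) = begin
  select b (true ∷ 0ᵇ) +ᵇ lincomb (V.map (false ∷_) (units n)) t
    ≡⟨ cong (select b (true ∷ 0ᵇ) +ᵇ_) (lincomb-false∷ (units n) t) ⟩
  select b (true ∷ 0ᵇ) +ᵇ (false ∷ lincomb (units n) t)
    ≡⟨ cong (λ u → select b (true ∷ 0ᵇ) +ᵇ (false ∷ u)) (lincomb-units n t) ⟩
  select b (true ∷ 0ᵇ) +ᵇ (false ∷ t)
    ≡⟨ select-unit b ⟩
  b ∷ t ∎
  where
  open ≡-Reasoning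
  select-unit : ∀ b → select b (true ∷ 0ᵇ) +ᵇ (false ∷ t) ≡ b ∷ t
  select-unit true  = cong (true ∷_) (+ᵇ-identityˡ t)
  select-unit false = cong (false ∷_) (+ᵇ-identityˡ t)

allBits : ∀ n → List (Bits n)
allBits zero    = [] ∷ []
allBits (suc n) = map (true ∷_) (allBits n) ++ map (false ∷_) (allBits n)

∈-allBits : ∀ {n} (u : Bits n) → u ∈ₗ allBits n
∈-allBits []          = here refl
∈-allBits (true ∷ u)  = ∈-++⁺ˡ (∈-map⁺ (true ∷_) (∈-allBits u))
∈-allBits (false ∷ u) = ∈-++⁺ʳ (map (true ∷_) (allBits _)) (∈-map⁺ (false ∷_) (∈-allBits u))

allBits-unique : ∀ n → Unique (allBits n)
allBits-unique zero    = [] ∷ []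
allBits-unique (suc n) =
  Unique.++⁺ (Unique.map⁺ V.∷-injectiveʳ (allBits-unique n)) (Unique.map⁺ V.∷-injectiveʳ (allBits-unique n))
    λ (t∈ , f∈) → case trans (sym (proj₂ (proj₂ (∈-map⁻ (true ∷_) t∈))))
                             (proj₂ (proj₂ (∈-map⁻ (false ∷_) f∈))) of λ ()

length-allBits : ∀ n → length (allBits n) ≡ 2 ^ n
length-allBits zero    = refl
length-allBits (suc n) = begin
  length (map (true ∷_) (allBits n) ++ map (false ∷_) (allBits n))
    ≡⟨ length-++ (map (true ∷_) (allBits n)) ⟩
  length (map (true ∷_) (allBits n)) + length (map (false ∷_) (allBits n))
    ≡⟨ cong₂ _+_ (length-map _ (allBits n)) (length-map _ (allBits n)) ⟩
  length (allBits n) + length (allBits n)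
    ≡⟨ cong (λ l → l + l) (length-allBits n) ⟩
  2 ^ n + 2 ^ n
    ≡⟨ cong (λ l → 2 ^ n + l) (sym (ℕ.+-identityʳ (2 ^ n))) ⟩
  2 ^ suc n ∎
  where open ≡-Reasoning

injection⇒≤ : ∀ {n k} (g : Bits n → Bits k) → (∀ {u w} → g u ≡ g w → u ≡ w) → n ≤ k
injection⇒≤ {n} {k} g g-injective =
  ℕ.≮⇒≥ λ k<n → ℕ.<⇒≱ (ℕ.^-monoʳ-< 2 (s≤s (s≤s z≤n)) k<n) 2ⁿ≤2ᵏ
  where
  2ⁿ≤2ᵏ : 2 ^ n ≤ 2 ^ k
  2ⁿ≤2ᵏ = subst₂ _≤_ (trans (length-map g (allBits n)) (length-allBits n)) (length-allBits k)
            (unique-⊆⇒length-≤ (Unique.map⁺ g-injective (allBits-unique n)) (λ {z} _ → ∈-allBits z))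

spanning⇒≤ : ∀ {n k} (ws : Vec (Bits n) k) → (∀ i → Span ws (V.lookup (units n) i)) → n ≤ k
spanning⇒≤ {n} {k} ws units∈ws = injection⇒≤ coefficients coefficients-injective
  where
  span : ∀ t → Span ws t
  span t = subst (Span ws) (lincomb-units n t) (Span-lincomb ws (units n) units∈ws t)
  coefficients : Bits n → Bits k
  coefficients t = proj₁ (span t)
  coefficients-injective : ∀ {t u} → coefficients t ≡ coefficients u → t ≡ u
  coefficients-injective {t} {u} eq =
    trans (sym (proj₂ (span t))) (trans (cong (lincomb ws) eq) (proj₂ (span u)))

-- Filling closure

data Rule (v : Point) : Point → Point → Point → Set where
  rule₀ : Rule v (corner₁ v) (corner₂ v) (corner₀ v)
  rule₁ : Rule v (corner₀ v) (corner₂ v) (corner₁ v)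
  rule₂ : Rule v (corner₀ v) (corner₁ v) (corner₂ v)

Closed : Pred Point 0ℓ → Set
Closed C = ∀ {v a b c} → Rule v a b c → C a → C b → C c

Rule-premises : ∀ {v a b c} → Rule v a b c → InTri v a × InTri v b
Rule-premises rule₀ = inj₂ (inj₁ refl) , inj₂ (inj₂ refl)
Rule-premises rule₁ = inj₁ refl , inj₂ (inj₂ refl)
Rule-premises rule₂ = inj₁ refl , inj₂ (inj₁ refl)

Fill-closed : ∀ {S} → Closed (Fill S)
Fill-closed {v = v} rule₀ = fill₀ v
Fill-closed {v = v} rule₁ = fill₁ v
Fill-closed {v = v} rule₂ = fill₂ v

Fill-least : ∀ {S C} → Closed C → S ⊆ C → Fill S ⊆ C
Fill-least cl S⊆C (base s)      = S⊆C s
Fill-least cl S⊆C (fill₀ v p q) = cl {v} rule₀ (Fill-least cl S⊆C p) (Fill-least cl S⊆C q)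
Fill-least cl S⊆C (fill₁ v p q) = cl {v} rule₁ (Fill-least cl S⊆C p) (Fill-least cl S⊆C q)
Fill-least cl S⊆C (fill₂ v p q) = cl {v} rule₂ (Fill-least cl S⊆C p) (Fill-least cl S⊆C q)

Fill-mono : ∀ {S T} → S ⊆ T → Fill S ⊆ Fill T
Fill-mono S⊆T = Fill-least Fill-closed (base ∘ S⊆T)

Indispensable : Pred Point 0ℓ → Pred Point 0ℓ → Point → Set
Indispensable C S x = ∃[ y ] (C y × ¬ Fill (S ∩ (_≢ x)) y)

Indispensable-mono : ∀ {C C′ S S′ x} → C ⊆ C′ → S′ ⊆ S → Indispensable C S x → Indispensable C′ S′ x
Indispensable-mono C⊆C′ S′⊆S (y , y∈C , y∉) = y , C⊆C′ y∈C , y∉ ∘ Fill-mono (λ (z∈S′ , z≢x) → S′⊆S z∈S′ , z≢x)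

⊕-assoc : ∀ p q r → (p ⊕ q) ⊕ r ≡ p ⊕ (q ⊕ r)
⊕-assoc (a , b) (c , d) (e , f) = cong₂ _,_ (ℤ.+-assoc a c e) (ℤ.+-assoc b d f)

⊕-identityʳ : ∀ p → p ⊕ (+ 0 , + 0) ≡ p
⊕-identityʳ (a , b) = cong₂ _,_ (ℤ.+-identityʳ a) (ℤ.+-identityʳ b)

⊕-comm-assoc : ∀ p o t → (p ⊕ o) ⊕ t ≡ (p ⊕ t) ⊕ o
⊕-comm-assoc (a , b) (c , d) (e , f) = cong₂ _,_ (xy∙z≈xz∙y a c e) (xy∙z≈xz∙y b d f)

infix 30 ⊝_
⊝_ : Point → Point
⊝ (a , b) = (ℤ.- a , ℤ.- b)

⊕-⊝-cancel : ∀ p t → (p ⊕ t) ⊕ ⊝ t ≡ p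
⊕-⊝-cancel p t@(c , d) = trans (⊕-assoc p t (⊝ t))
  (trans (cong (p ⊕_) (cong₂ _,_ (ℤ.+-inverseʳ c) (ℤ.+-inverseʳ d))) (⊕-identityʳ p))

⊕-cancelʳ : ∀ t {p q} → p ⊕ t ≡ q ⊕ t → p ≡ q
⊕-cancelʳ t {p} {q} eq =
  trans (sym (⊕-⊝-cancel p t)) (trans (cong (_⊕ ⊝ t) eq) (⊕-⊝-cancel q t))

InTri-⊕ : ∀ t {v c} → InTri v c → InTri (v ⊕ t) (c ⊕ t)
InTri-⊕ t {v} (inj₁ refl)        = inj₁ (⊕-comm-assoc v _ t)
InTri-⊕ t {v} (inj₂ (inj₁ refl)) = inj₂ (inj₁ (⊕-comm-assoc v _ t))
InTri-⊕ t {v} (inj₂ (inj₂ refl)) = inj₂ (inj₂ (⊕-comm-assoc v _ t))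

Rule-subst : ∀ {v a a′ b b′ c c′} → a ≡ a′ → b ≡ b′ → c ≡ c′ → Rule v a′ b′ c′ → Rule v a b c
Rule-subst refl refl refl r = r

Rule-⊕ : ∀ t {v a b c} → Rule v a b c → Rule (v ⊕ t) (a ⊕ t) (b ⊕ t) (c ⊕ t)
Rule-⊕ t {v} rule₀ = Rule-subst (⊕-comm-assoc v _ t) (⊕-comm-assoc v _ t) (⊕-comm-assoc v _ t) rule₀
Rule-⊕ t {v} rule₁ = Rule-subst (⊕-comm-assoc v _ t) (⊕-comm-assoc v _ t) (⊕-comm-assoc v _ t) rule₁
Rule-⊕ t {v} rule₂ = Rule-subst (⊕-comm-assoc v _ t) (⊕-comm-assoc v _ t) (⊕-comm-assoc v _ t) rule₂

Fill-⊕ : ∀ t {S T} → (∀ {p} → S p → T (p ⊕ t)) → ∀ {x} → Fill S x → Fill T (x ⊕ t)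
Fill-⊕ t S⊆T = Fill-least (λ r → Fill-closed (Rule-⊕ t r)) (base ∘ S⊆T)

Separated : Pred Point 0ℓ → Pred Point 0ℓ → Set
Separated A B = ∀ v {p q} → InTri v p → InTri v q → A p → B q → ⊥

Fill-split : ∀ {A B S} → Closed A → Closed B → Separated A B → S ⊆ A ∪ B →
             Fill S ⊆ (A ∩ Fill (S ∩ A)) ∪ (B ∩ Fill (S ∩ B))
Fill-split {A} {B} {S} A-closed B-closed separated S⊆A∪B = Fill-least closed sorted
  where
  sorted : S ⊆ (A ∩ Fill (S ∩ A)) ∪ (B ∩ Fill (S ∩ B))
  sorted s with S⊆A∪B s
  ... | inj₁ a = inj₁ (a , base (s , a))
  ... | inj₂ b = inj₂ (b , base (s , b))
  closed : Closed ((A ∩ Fill (S ∩ A)) ∪ (B ∩ Fill (S ∩ B)))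
  closed r (inj₁ (a , fa)) (inj₁ (a′ , fa′)) = inj₁ (A-closed r a a′ , Fill-closed r fa fa′)
  closed r (inj₂ (b , fb)) (inj₂ (b′ , fb′)) = inj₂ (B-closed r b b′ , Fill-closed r fb fb′)
  closed {v} r (inj₁ (a , _)) (inj₂ (b , _)) =
    ⊥-elim (separated v (proj₁ (Rule-premises r)) (proj₂ (Rule-premises r)) a b)
  closed {v} r (inj₂ (b , _)) (inj₁ (a , _)) =
    ⊥-elim (separated v (proj₂ (Rule-premises r)) (proj₁ (Rule-premises r)) a b)

candidates : List Point → List Point
candidates L = L ++ map (_⊕ ⊝ (+ 1 , + 0)) L

corner₀-candidate : ∀ {v L} → corner₀ v ∈ L → v ∈ candidates L
corner₀-candidate {v} c∈L = ∈-++⁺ˡ (subst (_∈ _) (⊕-identityʳ v) c∈L)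

corner₁-candidate : ∀ {v L} → corner₁ v ∈ L → v ∈ candidates L
corner₁-candidate {v} {L} c∈L =
  ∈-++⁺ʳ L (subst (_∈ _) (⊕-⊝-cancel v _) (∈-map⁺ (_⊕ ⊝ (+ 1 , + 0)) c∈L))

Rule-candidate : ∀ {v a b c L} → Rule v a b c → a ∈ L → v ∈ candidates L
Rule-candidate {v} rule₀ = corner₁-candidate {v}
Rule-candidate {v} rule₁ = corner₀-candidate {v}
Rule-candidate {v} rule₂ = corner₀-candidate {v}

ClosedAt : List Point → Point → Set
ClosedAt L v = (corner₁ v ∈ L → corner₂ v ∈ L → corner₀ v ∈ L)
             × (corner₀ v ∈ L → corner₂ v ∈ L → corner₁ v ∈ L)
             × (corner₀ v ∈ L → corner₁ v ∈ L → corner₂ v ∈ L)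

closedAt? : ∀ L v → Dec (ClosedAt L v)
closedAt? L v = (corner₁ v ∈? L →-dec corner₂ v ∈? L →-dec corner₀ v ∈? L)
          ×-dec (corner₀ v ∈? L →-dec corner₂ v ∈? L →-dec corner₁ v ∈? L)
          ×-dec (corner₀ v ∈? L →-dec corner₁ v ∈? L →-dec corner₂ v ∈? L)

closed-by-candidates : ∀ {L} → All (ClosedAt L) (candidates L) → Closed ⟦ L ⟧
closed-by-candidates ok {v} rule₀ a b = proj₁ (All.lookup ok (corner₁-candidate {v} a)) a b
closed-by-candidates ok {v} rule₁ a b = proj₁ (proj₂ (All.lookup ok (corner₀-candidate {v} a))) a b
closed-by-candidates ok {v} rule₂ a b = proj₂ (proj₂ (All.lookup ok (corner₀-candidate {v} a))) a b

rules : Point → List (Point × Point × Point)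
rules v = (corner₁ v , corner₂ v , corner₀ v)
        ∷ (corner₀ v , corner₂ v , corner₁ v)
        ∷ (corner₀ v , corner₁ v , corner₂ v) ∷ []

rules-sound : ∀ {v a b c} → (a , b , c) ∈ₗ rules v → Rule v a b c
rules-sound (here refl)                 = rule₀
rules-sound (there (here refl))         = rule₁
rules-sound (there (there (here refl))) = rule₂

rules-complete : ∀ {v a b c} → Rule v a b c → (a , b , c) ∈ₗ rules v
rules-complete rule₀ = here refl
rules-complete rule₁ = there (here refl)
rules-complete rule₂ = there (there (here refl))

Applicable : List Point → Pred (Point × Point × Point) 0ℓ
Applicable L (a , b , _) = a ∈ L × b ∈ L

applicable? : ∀ L → Decidable (Applicable L)
applicable? L (a , b , _) = a ∈? L ×-dec b ∈? L

target : Point × Point × Point → Point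
target (_ , _ , c) = c

newly-filled : List Point → List Point
newly-filled L = deduplicate _≟P_ (filter (λ x → ¬? (x ∈? L))
                   (map target (filter (applicable? L) (concatMap rules (candidates L)))))

newly-filled-sound : ∀ {L S} → ⟦ L ⟧ ⊆ Fill S → ⟦ newly-filled L ⟧ ⊆ Fill S
newly-filled-sound {L} L⊆S x∈new
  with ∈-map⁻ target (proj₁ (∈-filter⁻ (λ x → ¬? (x ∈? L)) (∈-deduplicate⁻ _≟P_ _ x∈new)))
... | (a , b , c) , r∈ , refl with ∈-filter⁻ (applicable? L) r∈
... | r∈rules , a∈L , b∈L with Any.satisfied (∈-concatMap⁻ rules {xs = candidates L} r∈rules)
... | v , r∈rulesᵥ = Fill-closed (rules-sound {v} r∈rulesᵥ) (L⊆S a∈L) (L⊆S b∈L)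

-- Opaque so that type checking never unfolds the iteration on symbolic input; only the
-- certificates at the end unfold it, on concrete patterns.
opaque
  closure : ℕ → List Point → List Point
  closure zero    L = L
  closure (suc n) L = closure n (L ++ newly-filled L)

  closure-sound : ∀ n {L} → ⟦ closure n L ⟧ ⊆ Fill ⟦ L ⟧
  closure-sound n {L} = go n base
    where
    go : ∀ n {K} → ⟦ K ⟧ ⊆ Fill ⟦ L ⟧ → ⟦ closure n K ⟧ ⊆ Fill ⟦ L ⟧
    go zero    K⊆L = K⊆L
    go (suc n) {K} K⊆L = go n λ x∈ → Sum.[ K⊆L , newly-filled-sound K⊆L ]′ (∈-++⁻ K x∈)

  closure-⊇ : ∀ n {L} → ⟦ L ⟧ ⊆ ⟦ closure n L ⟧
  closure-⊇ zero    = λ x∈ → x∈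
  closure-⊇ (suc n) = closure-⊇ n ∘ ∈-++⁺ˡ

-- The triangle Δ₇

pt : ℕ → ℕ → Point
pt x y = (+ x , + y)

Δ₇ : List Point
Δ₇ = concatMap (λ y → map (λ x → pt x y) (upTo (7 ∸ y))) (upTo 7)

Δ₇-closed : Closed ⟦ Δ₇ ⟧
Δ₇-closed = closed-by-candidates {Δ₇} (from-yes (all? (closedAt? Δ₇) (candidates Δ₇)))

HalfPlane : ℤ → Pred Point 0ℓ
HalfPlane k p = k ℤ.≤ proj₁ p

NonNeg Far : Pred Point 0ℓ
NonNeg = HalfPlane (+ 0)
Far    = HalfPlane (+ 10)

HalfPlane-closed : ∀ k → Closed (HalfPlane k)
HalfPlane-closed k     rule₀ _ q = q
HalfPlane-closed k {v} rule₁ p _ = ℤ.≤-trans p (ℤ.+-monoʳ-≤ (proj₁ v) (ℤ.+≤+ z≤n))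
HalfPlane-closed k     rule₂ p _ = p

Far⇒NonNeg : Far ⊆ NonNeg
Far⇒NonNeg = ℤ.≤-trans (ℤ.+≤+ z≤n)

Δ₇-bounds : All (λ p → NonNeg p × proj₁ p ℤ.≤ + 6) Δ₇
Δ₇-bounds = from-yes (all? (λ p → (+ 0 ℤ.≤? proj₁ p) ×-dec (proj₁ p ℤ.≤? + 6)) Δ₇)

Δ₇⇒NonNeg : ⟦ Δ₇ ⟧ ⊆ NonNeg
Δ₇⇒NonNeg = proj₁ ∘ All.lookup Δ₇-bounds

Δ₇∩Far-empty : ∀ {p} → p ∈ Δ₇ → ¬ Far p
Δ₇∩Far-empty p∈ far = from-no (+ 10 ℤ.≤? + 6) (ℤ.≤-trans far (proj₂ (All.lookup Δ₇-bounds p∈)))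

InTri-x : ∀ {v p} → InTri v p → proj₁ v ℤ.≤ proj₁ p × proj₁ p ℤ.≤ proj₁ v ℤ.+ + 1
InTri-x {v} (inj₁ refl)        = ℤ.≤-reflexive (sym (ℤ.+-identityʳ _)) , ℤ.+-monoʳ-≤ (proj₁ v) (ℤ.+≤+ z≤n)
InTri-x {v} (inj₂ (inj₁ refl)) = ℤ.i≤i+j (proj₁ v) (+ 1) , ℤ.≤-refl
InTri-x {v} (inj₂ (inj₂ refl)) = ℤ.≤-reflexive (sym (ℤ.+-identityʳ _)) , ℤ.+-monoʳ-≤ (proj₁ v) (ℤ.+≤+ z≤n)

Δ₇-Far-separated : Separated ⟦ Δ₇ ⟧ Far
Δ₇-Far-separated v {p} {q} vp vq p∈Δ₇ q-far = from-no (+ 10 ℤ.≤? + 7) (begin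
  + 10                ≤⟨ q-far ⟩
  proj₁ q             ≤⟨ proj₂ (InTri-x {v} vq) ⟩
  proj₁ v ℤ.+ + 1     ≤⟨ ℤ.+-monoˡ-≤ (+ 1) (ℤ.≤-trans (proj₁ (InTri-x {v} vp)) p≤6) ⟩
  + 7                 ∎)
  where
  open ℤ.≤-Reasoning
  p≤6 : proj₁ p ℤ.≤ + 6
  p≤6 = proj₂ (All.lookup Δ₇-bounds p∈Δ₇)

Fill-split₇ : ∀ {S} → S ⊆ ⟦ Δ₇ ⟧ ∪ Far →
              Fill S ⊆ (⟦ Δ₇ ⟧ ∩ Fill (S ∩ ⟦ Δ₇ ⟧)) ∪ (Far ∩ Fill (S ∩ Far))
Fill-split₇ = Fill-split Δ₇-closed (HalfPlane-closed (+ 10)) Δ₇-Far-separated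

Fill-Δ₇-part : ∀ {S x} → S ⊆ ⟦ Δ₇ ⟧ ∪ Far → Fill S x → x ∈ Δ₇ → Fill (S ∩ ⟦ Δ₇ ⟧) x
Fill-Δ₇-part S⊆ fx x∈Δ₇ = case Fill-split₇ S⊆ fx of λ where
  (inj₁ (_ , f))     → f
  (inj₂ (x-far , _)) → ⊥-elim (Δ₇∩Far-empty x∈Δ₇ x-far)

Fill-Far-part : ∀ {S x} → S ⊆ ⟦ Δ₇ ⟧ ∪ Far → Fill S x → Far x → Fill (S ∩ Far) x
Fill-Far-part S⊆ fx x-far = case Fill-split₇ S⊆ fx of λ where
  (inj₁ (x∈Δ₇ , _)) → ⊥-elim (Δ₇∩Far-empty x∈Δ₇ x-far)
  (inj₂ (_ , f))    → f

e₁₀ : Point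
e₁₀ = (+ 10 , + 0)

shift unshift : Point → Point
shift p   = p ⊕ e₁₀
unshift p = p ⊕ ⊝ e₁₀

unshift-shift : ∀ p → unshift (shift p) ≡ p
unshift-shift p = ⊕-⊝-cancel p e₁₀

shift-unshift : ∀ p → shift (unshift p) ≡ p
shift-unshift p = ⊕-⊝-cancel p (⊝ e₁₀)

shift-Far : ∀ {p} → NonNeg p → Far (shift p)
shift-Far = ℤ.+-monoˡ-≤ (+ 10)

Fill-shift : ∀ {S T} → (∀ {p} → S p → T (shift p)) → ∀ {x} → Fill S x → Fill T (shift x)
Fill-shift = Fill-⊕ e₁₀

Fill-unshift : ∀ {S T} → (∀ {p} → S p → T (unshift p)) → ∀ {x} → Fill S x → Fill T (unshift x)
Fill-unshift = Fill-⊕ (⊝ e₁₀)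

mul-t : ∀ {n} → Bits n → Bits n
mul-t {zero}  u = u
mul-t {suc n} u = false ∷ V.init u

mul-1+t : ∀ {n} → Bits n → Bits n
mul-1+t u = u +ᵇ mul-t u

-- (x , y) ↦ tˣ (1 + t)ʸ in 𝔽₂[t]/(t⁷); points off the quadrant, which Δ₇ never reaches, go to 0.
bits : Point → Bits 7
bits (+ x , + y) = iterate mul-1+t (iterate mul-t (true ∷ 0ᵇ) x) y
bits _           = 0ᵇ

BitsRelation : Point × Point × Point → Set
BitsRelation (a , b , c) = a ∈ Δ₇ → b ∈ Δ₇ → bits c ≡ bits a +ᵇ bits b

bits-rule : ∀ {v a b c} → Rule v a b c → a ∈ Δ₇ → b ∈ Δ₇ → bits c ≡ bits a +ᵇ bits b
bits-rule r a∈Δ₇ = All.lookup (All.lookup checked (Rule-candidate r a∈Δ₇)) (rules-complete r) a∈Δ₇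
  where
  checked : All (All BitsRelation ∘ rules) (candidates Δ₇)
  checked = from-yes (all? (all? (λ (a , b , c) →
    a ∈? Δ₇ →-dec b ∈? Δ₇ →-dec V.≡-dec Bool._≟_ (bits c) (bits a +ᵇ bits b)) ∘ rules) (candidates Δ₇))

bitsOf : (R : List Point) → Vec (Bits 7) (length R)
bitsOf []      = []
bitsOf (r ∷ R) = bits r ∷ bitsOf R

Span-bitsOf : ∀ {R x} → x ∈ R → Span (bitsOf R) (bits x)
Span-bitsOf {r ∷ R} (here refl) =
  (true ∷ 0ᵇ) , trans (cong (bits r +ᵇ_) (lincomb-0 (bitsOf R))) (+ᵇ-identityʳ (bits r))
Span-bitsOf {r ∷ R} (there x∈) =
  let s , eq = Span-bitsOf x∈ in (false ∷ s) , trans (+ᵇ-identityˡ _) eq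

Fill-bits : ∀ {R} → ⟦ R ⟧ ⊆ ⟦ Δ₇ ⟧ → Fill ⟦ R ⟧ ⊆ λ x → x ∈ Δ₇ × Span (bitsOf R) (bits x)
Fill-bits {R} R⊆Δ₇ = Fill-least closed (λ x∈ → R⊆Δ₇ x∈ , Span-bitsOf x∈)
  where
  closed : Closed λ x → x ∈ Δ₇ × Span (bitsOf R) (bits x)
  closed r (a∈ , a-span) (b∈ , b-span) =
    Δ₇-closed r a∈ b∈ ,
    subst (Span (bitsOf R)) (sym (bits-rule r a∈ b∈)) (Span-+ {ws = bitsOf R} a-span b-span)

Δ₇-generators-≥7 : ∀ R → ⟦ R ⟧ ⊆ ⟦ Δ₇ ⟧ → ⟦ Δ₇ ⟧ ⊆ Fill ⟦ R ⟧ → 7 ≤ length R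
Δ₇-generators-≥7 R R⊆Δ₇ Δ₇⊆R = spanning⇒≤ (bitsOf R) λ i →
  subst (Span (bitsOf R)) (bottom-row i) (proj₂ (Fill-bits R⊆Δ₇ (Δ₇⊆R (bottom-row∈Δ₇ i))))
  where
  bottom-row : ∀ i → bits (pt (toℕ i) 0) ≡ V.lookup (units 7) i
  bottom-row = from-yes (Fin.all? {n = 7} λ i → V.≡-dec Bool._≟_ (bits (pt (toℕ i) 0)) (V.lookup (units 7) i))
  bottom-row∈Δ₇ : ∀ i → pt (toℕ i) 0 ∈ Δ₇
  bottom-row∈Δ₇ = from-yes (Fin.all? {n = 7} λ i → pt (toℕ i) 0 ∈? Δ₇)

-- Translated copies

copies : List Point → ℕ → List Point
copies X zero    = []
copies X (suc m) = X ++ map shift (copies X m)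

data CopiesView (X : List Point) (m : ℕ) : Point → Set where
  first : ∀ {x} → x ∈ X → CopiesView X m x
  later : ∀ {q} → q ∈ copies X m → CopiesView X m (shift q)

copies-view : ∀ X m {x} → x ∈ copies X (suc m) → CopiesView X m x
copies-view X m x∈ with ∈-++⁻ X x∈
... | inj₁ x∈X  = first x∈X
... | inj₂ x∈sh with ∈-map⁻ shift x∈sh
...   | q , q∈ , refl = later q∈

shift-∈-copies : ∀ X m {q} → q ∈ copies X m → shift q ∈ copies X (suc m)
shift-∈-copies X m q∈ = ∈-++⁺ʳ X (∈-map⁺ shift q∈)

copies-mono : ∀ {X Y} → ⟦ X ⟧ ⊆ ⟦ Y ⟧ → ∀ m → ⟦ copies X m ⟧ ⊆ ⟦ copies Y m ⟧
copies-mono {X} {Y} X⊆Y (suc m) x∈ with copies-view X m x∈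
... | first x∈X = ∈-++⁺ˡ (X⊆Y x∈X)
... | later q∈  = shift-∈-copies Y m (copies-mono X⊆Y m q∈)

length-copies : ∀ X m → length (copies X m) ≡ m * length X
length-copies X zero    = refl
length-copies X (suc m) =
  trans (length-++ X) (cong (λ l → length X + l) (trans (length-map shift (copies X m)) (length-copies X m)))

module _ {X : List Point} (X⊆Δ₇ : ⟦ X ⟧ ⊆ ⟦ Δ₇ ⟧) where

  copies-NonNeg : ∀ m → ⟦ copies X m ⟧ ⊆ NonNeg
  copies-NonNeg (suc m) x∈ with copies-view X m x∈
  ... | first x∈X = Δ₇⇒NonNeg (X⊆Δ₇ x∈X)
  ... | later {q} q∈ = Far⇒NonNeg {shift q} (shift-Far {q} (copies-NonNeg m q∈))

  copies-split : ∀ m → ⟦ copies X (suc m) ⟧ ⊆ ⟦ Δ₇ ⟧ ∪ Far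
  copies-split m x∈ with copies-view X m x∈
  ... | first x∈X = inj₁ (X⊆Δ₇ x∈X)
  ... | later {q} q∈ = inj₂ (shift-Far {q} (copies-NonNeg m q∈))

  copies-Δ₇ : ∀ m {x} → x ∈ copies X (suc m) → x ∈ Δ₇ → x ∈ X
  copies-Δ₇ m x∈ x∈Δ₇ with copies-view X m x∈
  ... | first x∈X = x∈X
  ... | later {q} q∈ = ⊥-elim (Δ₇∩Far-empty x∈Δ₇ (shift-Far {q} (copies-NonNeg m q∈)))

  copies-Far : ∀ m {x} → x ∈ copies X (suc m) → Far x → unshift x ∈ copies X m
  copies-Far m x∈ x-far with copies-view X m x∈
  ... | first x∈X     = ⊥-elim (Δ₇∩Far-empty (X⊆Δ₇ x∈X) x-far)
  ... | later {q} q∈ = subst (_∈ copies X m) (sym (unshift-shift q)) q∈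

  copies-unique : Unique X → ∀ m → Unique (copies X m)
  copies-unique X-unique zero    = []
  copies-unique X-unique (suc m) =
    Unique.++⁺ X-unique (Unique.map⁺ (⊕-cancelʳ e₁₀) (copies-unique X-unique m))
      λ (x∈X , x∈sh) → case ∈-map⁻ shift x∈sh of λ where
        (q , q∈ , refl) → Δ₇∩Far-empty (X⊆Δ₇ x∈X) (shift-Far {q} (copies-NonNeg m q∈))

  Fill-copies⊆ : ∀ m → Fill ⟦ copies X m ⟧ ⊆ ⟦ copies Δ₇ m ⟧
  Fill-copies⊆ zero    = Fill-least {C = ⟦ [] ⟧} (λ _ ()) (λ ())
  Fill-copies⊆ (suc m) {x} fx = case Fill-split₇ (copies-split m) fx of λ where
    (inj₁ (x∈Δ₇ , _)) → ∈-++⁺ˡ x∈Δ₇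
    (inj₂ (_ , f-far)) → subst (_∈ copies Δ₇ (suc m)) (shift-unshift x)
      (shift-∈-copies Δ₇ m (Fill-copies⊆ m (Fill-unshift (λ (p∈ , p-far) → copies-Far m p∈ p-far) f-far)))

copies-Δ₇-NonNeg : ∀ m → ⟦ copies Δ₇ m ⟧ ⊆ NonNeg
copies-Δ₇-NonNeg = copies-NonNeg (λ x∈ → x∈)

copies⊆Fill : ∀ {X} → ⟦ Δ₇ ⟧ ⊆ Fill ⟦ X ⟧ → ∀ m → ⟦ copies Δ₇ m ⟧ ⊆ Fill ⟦ copies X m ⟧
copies⊆Fill {X} Δ₇⊆X (suc m) x∈ with copies-view Δ₇ m x∈
... | first x∈Δ₇ = Fill-mono ∈-++⁺ˡ (Δ₇⊆X x∈Δ₇)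
... | later q∈   = Fill-shift (shift-∈-copies X m) (copies⊆Fill Δ₇⊆X m q∈)

copies-disjoint : ∀ {X Y} → ⟦ X ⟧ ⊆ ⟦ Δ₇ ⟧ → ⟦ Y ⟧ ⊆ ⟦ Δ₇ ⟧ → (∀ {x} → x ∈ X → x ∉ Y) →
                  ∀ m {x} → x ∈ copies X m → x ∉ copies Y m
copies-disjoint X⊆Δ₇ Y⊆Δ₇ X∩Y=∅ (suc m) x∈X′ x∈Y′ = case copies-split X⊆Δ₇ m x∈X′ of λ where
  (inj₁ x∈Δ₇) → X∩Y=∅ (copies-Δ₇ X⊆Δ₇ m x∈X′ x∈Δ₇) (copies-Δ₇ Y⊆Δ₇ m x∈Y′ x∈Δ₇)
  (inj₂ x-far) → copies-disjoint X⊆Δ₇ Y⊆Δ₇ X∩Y=∅ m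
                   (copies-Far X⊆Δ₇ m x∈X′ x-far) (copies-Far Y⊆Δ₇ m x∈Y′ x-far)

copies-generators-≥ : ∀ m R → ⟦ R ⟧ ⊆ ⟦ copies Δ₇ m ⟧ → ⟦ copies Δ₇ m ⟧ ⊆ Fill ⟦ R ⟧ → m * 7 ≤ length R
copies-generators-≥ zero    R _    _     = z≤n
copies-generators-≥ (suc m) R R⊆Δ′ Δ′⊆R =
  subst (suc m * 7 ≤_)
        (trans (cong (λ l → length inner + l) (length-map unshift outer)) (length-filter-¬ (_∈? Δ₇) R))
    (ℕ.+-mono-≤ (Δ₇-generators-≥7 inner (proj₂ ∘ ∈-filter⁻ (_∈? Δ₇) {xs = R}) Δ₇⊆inner)
                (copies-generators-≥ m (map unshift outer) outer⊆copies copies⊆outer))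
  where
  inner outer : List Point
  inner = filter (_∈? Δ₇) R
  outer = filter (λ x → ¬? (x ∈? Δ₇)) R
  split : ⟦ R ⟧ ⊆ ⟦ Δ₇ ⟧ ∪ Far
  split = copies-split (λ x∈ → x∈) m ∘ R⊆Δ′
  Δ₇⊆inner : ⟦ Δ₇ ⟧ ⊆ Fill ⟦ inner ⟧
  Δ₇⊆inner x∈Δ₇ = Fill-mono (λ (p∈R , p∈Δ₇) → ∈-filter⁺ (_∈? Δ₇) p∈R p∈Δ₇)
                            (Fill-Δ₇-part split (Δ′⊆R (∈-++⁺ˡ x∈Δ₇)) x∈Δ₇)
  outer⊆copies : ⟦ map unshift outer ⟧ ⊆ ⟦ copies Δ₇ m ⟧
  outer⊆copies x∈ = case ∈-map⁻ unshift x∈ of λ where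
    (p , p∈ , refl) → let p∈R , p∉Δ₇ = ∈-filter⁻ (λ x → ¬? (x ∈? Δ₇)) p∈ in
      copies-Far (λ x∈ → x∈) m (R⊆Δ′ p∈R) (Sum.[ ⊥-elim ∘ p∉Δ₇ , (λ far → far) ]′ (split p∈R))
  copies⊆outer : ⟦ copies Δ₇ m ⟧ ⊆ Fill ⟦ map unshift outer ⟧
  copies⊆outer {z} z∈ = subst (Fill _) (unshift-shift z)
    (Fill-unshift (λ (p∈R , p-far) → ∈-map⁺ unshift
                     (∈-filter⁺ (λ x → ¬? (x ∈? Δ₇)) p∈R (λ p∈Δ₇ → Δ₇∩Far-empty p∈Δ₇ p-far)))
      (Fill-Far-part split (Δ′⊆R (shift-∈-copies Δ₇ m z∈)) (shift-Far {z} (copies-Δ₇-NonNeg m z∈))))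

copies-indispensable : ∀ {X} → ⟦ X ⟧ ⊆ ⟦ Δ₇ ⟧ → (∀ {x} → x ∈ X → Indispensable ⟦ Δ₇ ⟧ ⟦ X ⟧ x) →
                       ∀ m {x} → x ∈ copies X m → Indispensable ⟦ copies Δ₇ m ⟧ ⟦ copies X m ⟧ x
copies-indispensable {X} X⊆Δ₇ indispensable (suc m) x∈ with copies-view X m x∈
... | first x∈X =
  let y , y∈Δ₇ , y∉ = indispensable x∈X in
  y , ∈-++⁺ˡ y∈Δ₇ , λ fy → y∉ (Fill-mono (λ ((p∈ , p≢x) , p∈Δ₇) → copies-Δ₇ X⊆Δ₇ m p∈ p∈Δ₇ , p≢x)
                                          (Fill-Δ₇-part (copies-split X⊆Δ₇ m ∘ proj₁) fy y∈Δ₇))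
... | later {q} q∈ =
  let y , y∈ , y∉ = copies-indispensable X⊆Δ₇ indispensable m q∈ in
  shift y , shift-∈-copies Δ₇ m y∈ , λ fy → y∉ (subst (Fill _) (unshift-shift y)
    (Fill-unshift (λ {p} ((p∈ , p≢) , p-far) → copies-Far X⊆Δ₇ m p∈ p-far ,
                     λ eq → p≢ (trans (sym (shift-unshift p)) (cong shift eq)))
      (Fill-Far-part (copies-split X⊆Δ₇ m ∘ proj₁) fy (shift-Far {y} (copies-Δ₇-NonNeg m y∈)))))

remove : List Point → List Point → List Point
remove Q = filter (λ x → ¬? (x ∈? Q))

ExcessSet-[] : ∀ P → ExcessSet P []
ExcessSet-[] P = [] , [] , λ x → mk⇔ (Fill-mono proj₁) (Fill-mono (λ x∈P → x∈P , λ ()))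

ExcessSet-by-generation : ∀ {P Q} → ⟦ P ⟧ ⊆ ⟦ Δ₇ ⟧ → Unique Q → All (_∈ P) Q →
                          ⟦ Δ₇ ⟧ ⊆ Fill ⟦ remove Q P ⟧ → ExcessSet P Q
ExcessSet-by-generation {P} {Q} P⊆Δ₇ Q-unique Q⊆P Δ₇⊆rest = Q-unique , Q⊆P , λ x →
  mk⇔ (Fill-mono proj₁) (Fill-mono (∈-filter⁻ (λ x → ¬? (x ∈? Q))) ∘ Δ₇⊆rest ∘ Fill-least Δ₇-closed P⊆Δ₇)

maximal-by-indispensability :
  ∀ {P Q} → ExcessSet P Q → (∀ {x} → x ∈ P → x ∉ Q → Indispensable (Fill ⟦ P ⟧) (P ∖ Q) x) →
  MaximalExcessSet P Q
maximal-by-indispensability {P} {Q} Q-excess indispensable = Q-excess , maximal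
  where
  maximal : ∀ Q′ → ExcessSet P Q′ → (∀ x → x ∈ Q → x ∈ Q′) → ∀ x → x ∈ Q′ → x ∈ Q
  maximal Q′ (_ , Q′⊆P , P∖Q′≈P) Q⊆Q′ x x∈Q′ with x ∈? Q
  ... | yes x∈Q = x∈Q
  ... | no  x∉Q =
    let y , fy , y∉ = indispensable (All.lookup Q′⊆P x∈Q′) x∉Q in
    ⊥-elim (y∉ (Fill-mono (λ (z∈P , z∉Q′) → (z∈P , z∉Q′ ∘ Q⊆Q′ _) , λ { refl → z∉Q′ x∈Q′ })
                          (from (P∖Q′≈P y) fy)))

maximal-by-generation :
  ∀ {P Q} → ⟦ P ⟧ ⊆ ⟦ Δ₇ ⟧ → Unique Q → All (_∈ P) Q → ⟦ Δ₇ ⟧ ⊆ Fill ⟦ remove Q P ⟧ →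
  (∀ {x} → x ∈ remove Q P → Indispensable ⟦ Δ₇ ⟧ ⟦ remove Q P ⟧ x) → MaximalExcessSet P Q
maximal-by-generation {P} {Q} P⊆Δ₇ Q-unique Q⊆P Δ₇⊆rest indispensable =
  maximal-by-indispensability (ExcessSet-by-generation P⊆Δ₇ Q-unique Q⊆P Δ₇⊆rest) λ x∈P x∉Q →
    Indispensable-mono (Fill-mono (proj₁ ∘ ∈-filter⁻ Q∌?) ∘ Δ₇⊆rest)
                       (λ (z∈P , z∉Q) → ∈-filter⁺ Q∌? z∈P z∉Q)
                       (indispensable (∈-filter⁺ Q∌? x∈P x∉Q))
  where
  Q∌? : Decidable (_∉ Q)
  Q∌? x = ¬? (x ∈? Q)

only-[]-if-maximal : ∀ {P Q} → MaximalExcessSet P [] → ExcessSet P Q → Q ≡ []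
only-[]-if-maximal {Q = []}    _             _        = refl
only-[]-if-maximal {Q = q ∷ Q} (_ , maximal) Q-excess =
  case maximal (q ∷ Q) Q-excess (λ _ ()) q (here refl) of λ ()

GeneratorsAtLeast : List Point → ℕ → Set
GeneratorsAtLeast P k = ∀ R → SameFill ⟦ R ⟧ ⟦ P ⟧ → k ≤ length R

ExcessSet-length : ∀ {P Q k} → GeneratorsAtLeast P k → ExcessSet P Q → length Q + k ≤ length P
ExcessSet-length {P} {Q} {k} P-generators (Q-unique , Q⊆P , P∖Q≈P) =
  subst (length Q + k ≤_) (length-filter-¬ (_∈? Q) P)
    (ℕ.+-mono-≤ (unique-⊆⇒length-≤ Q-unique λ x∈Q → ∈-filter⁺ (_∈? Q) (All.lookup Q⊆P x∈Q) x∈Q)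
                (P-generators (remove Q P) rest≈P))
  where
  rest≈P : SameFill ⟦ remove Q P ⟧ ⟦ P ⟧
  rest≈P x = mk⇔ (to (P∖Q≈P x) ∘ Fill-mono (∈-filter⁻ (λ x → ¬? (x ∈? Q))))
                 (Fill-mono (λ (z∈P , z∉Q) → ∈-filter⁺ (λ x → ¬? (x ∈? Q)) z∈P z∉Q) ∘ from (P∖Q≈P x))

-- Moves

length-filter-cong : ∀ {P Q : Pred Point 0ℓ} (P? : Decidable P) (Q? : Decidable Q) {xs ys} →
                     Pointwise (λ x y → P x ⇔ Q y) xs ys → length (filter P? xs) ≡ length (filter Q? ys)
length-filter-cong P? Q? [] = refl
length-filter-cong P? Q? {x ∷ _} {y ∷ _} (x≈y ∷ xs≈ys) with P? x | Q? y
... | yes _  | yes _ = cong suc (length-filter-cong P? Q? xs≈ys)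
... | no  _  | no  _ = length-filter-cong P? Q? xs≈ys
... | yes px | no ¬qy = ⊥-elim (¬qy (to x≈y px))
... | no ¬px | yes qy = ⊥-elim (¬px (from x≈y qy))

countIn-cong : ∀ {P P′ v w} → (corner₀ v ∈ P ⇔ corner₀ w ∈ P′) → (corner₁ v ∈ P ⇔ corner₁ w ∈ P′) →
               (corner₂ v ∈ P ⇔ corner₂ w ∈ P′) → countIn P v ≡ countIn P′ w
countIn-cong {P} {P′} e₀ e₁ e₂ = length-filter-cong (_∈? P) (_∈? P′) (e₀ ∷ e₁ ∷ e₂ ∷ [])

Move-frame : ∀ {X Y X′ Y′ Z} (mv : Move X Y) → (∀ {c} → InTri (proj₁ mv) c → c ∉ Z) →
             (∀ {x} → x ∈ X′ ⇔ (x ∈ X ⊎ x ∈ Z)) → (∀ {x} → x ∈ Y′ ⇔ (x ∈ Y ⊎ x ∈ Z)) → Move X′ Y′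
Move-frame {X} {Y} {X′} {Y′} {Z} (v , cX , cY , a , b , a≢b , va , vb , sd) Z∌ X′≈ Y′≈ =
  v , count {X} X′≈ cX , count {Y} Y′≈ cY , a , b , a≢b , va , vb , λ x →
  mk⇔ (to (sd x) ∘ Sum.map (forget X′≈ Y′≈) (forget Y′≈ X′≈))
      (λ x≡ → Sum.map (add X′≈ Y′≈ (Z∌ (corner x≡))) (add Y′≈ X′≈ (Z∌ (corner x≡))) (from (sd x) x≡))
  where
  count : ∀ {W W′} → (∀ {x} → x ∈ W′ ⇔ (x ∈ W ⊎ x ∈ Z)) → countIn W v ≡ 2 → countIn W′ v ≡ 2
  count {W} {W′} W′≈ =
    trans (countIn-cong {W′} {W} {v} {v} (same (inj₁ refl)) (same (inj₂ (inj₁ refl))) (same (inj₂ (inj₂ refl))))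
    where
    same : ∀ {c} → InTri v c → c ∈ W′ ⇔ c ∈ W
    same vc = mk⇔ (λ c∈ → Sum.[ (λ c∈W → c∈W) , ⊥-elim ∘ Z∌ vc ]′ (to W′≈ c∈)) (from W′≈ ∘ inj₁)
  forget : ∀ {W W′ U U′ x} → (∀ {x} → x ∈ W′ ⇔ (x ∈ W ⊎ x ∈ Z)) → (∀ {x} → x ∈ U′ ⇔ (x ∈ U ⊎ x ∈ Z)) →
           x ∈ W′ × x ∉ U′ → x ∈ W × x ∉ U
  forget W′≈ U′≈ (x∈W′ , x∉U′) =
    Sum.[ (λ x∈W → x∈W) , ⊥-elim ∘ x∉U′ ∘ from U′≈ ∘ inj₂ ]′ (to W′≈ x∈W′) , x∉U′ ∘ from U′≈ ∘ inj₁
  add : ∀ {W W′ U U′ x} → (∀ {x} → x ∈ W′ ⇔ (x ∈ W ⊎ x ∈ Z)) → (∀ {x} → x ∈ U′ ⇔ (x ∈ U ⊎ x ∈ Z)) →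
        x ∉ Z → x ∈ W × x ∉ U → x ∈ W′ × x ∉ U′
  add W′≈ U′≈ x∉Z (x∈W , x∉U) = from W′≈ (inj₁ x∈W) , Sum.[ x∉U , x∉Z ]′ ∘ to U′≈
  corner : ∀ {x} → x ≡ a ⊎ x ≡ b → InTri v x
  corner (inj₁ refl) = va
  corner (inj₂ refl) = vb

Move-frameʳ : ∀ {X Y Z} (mv : Move X Y) → (∀ {c} → InTri (proj₁ mv) c → c ∉ Z) → Move (X ++ Z) (Y ++ Z)
Move-frameʳ {X} {Y} mv Z∌ = Move-frame mv Z∌ (mk⇔ (∈-++⁻ X) Sum.[ ∈-++⁺ˡ , ∈-++⁺ʳ X ]′)
                                             (mk⇔ (∈-++⁻ Y) Sum.[ ∈-++⁺ˡ , ∈-++⁺ʳ Y ]′)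

Move-frameˡ : ∀ {X Y Z} (mv : Move X Y) → (∀ {c} → InTri (proj₁ mv) c → c ∉ Z) → Move (Z ++ X) (Z ++ Y)
Move-frameˡ {Z = Z} mv Z∌ = Move-frame mv Z∌ (mk⇔ (Sum.swap ∘ ∈-++⁻ Z) Sum.[ ∈-++⁺ʳ Z , ∈-++⁺ˡ ]′)
                                             (mk⇔ (Sum.swap ∘ ∈-++⁻ Z) Sum.[ ∈-++⁺ʳ Z , ∈-++⁺ˡ ]′)

∈-map-⊕ : ∀ t {p X} → p ⊕ t ∈ map (_⊕ t) X ⇔ p ∈ X
∈-map-⊕ t {X = X} = mk⇔ (λ p∈ → case ∈-map⁻ (_⊕ t) p∈ of λ where
                            (q , q∈ , eq) → subst (_∈ X) (sym (⊕-cancelʳ t eq)) q∈)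
                        (∈-map⁺ (_⊕ t))

SymDiff-⊕ : ∀ t {X Y p} → SymDiff (map (_⊕ t) X) (map (_⊕ t) Y) (p ⊕ t) ⇔ SymDiff X Y p
SymDiff-⊕ t = mk⇔ (Sum.map (Product.map (to (∈-map-⊕ t)) (_∘ from (∈-map-⊕ t)))
                           (Product.map (to (∈-map-⊕ t)) (_∘ from (∈-map-⊕ t))))
                  (Sum.map (Product.map (from (∈-map-⊕ t)) (_∘ to (∈-map-⊕ t)))
                           (Product.map (from (∈-map-⊕ t)) (_∘ to (∈-map-⊕ t))))

Move-⊕ : ∀ t {X Y} → Move X Y → Move (map (_⊕ t) X) (map (_⊕ t) Y)
Move-⊕ t {X} {Y} (v , cX , cY , a , b , a≢b , va , vb , sd) =
  v ⊕ t , count {X} cX , count {Y} cY , a ⊕ t , b ⊕ t , a≢b ∘ ⊕-cancelʳ t ,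
  InTri-⊕ t {v} va , InTri-⊕ t {v} vb , λ x →
  mk⇔ (λ d → case preimage d of λ where
         (q , refl) → Sum.map (cong (_⊕ t)) (cong (_⊕ t)) (to (sd q) (to (SymDiff-⊕ t) d)))
      Sum.[ (λ { refl → from (SymDiff-⊕ t) (from (sd a) (inj₁ refl)) })
          , (λ { refl → from (SymDiff-⊕ t) (from (sd b) (inj₂ refl)) }) ]′
  where
  count : ∀ {W} → countIn W v ≡ 2 → countIn (map (_⊕ t) W) (v ⊕ t) ≡ 2
  count {W} = trans (countIn-cong {map (_⊕ t) W} {W} {v ⊕ t} {v}
    (moved (⊕-comm-assoc v _ t)) (moved (⊕-comm-assoc v _ t)) (moved (⊕-comm-assoc v _ t)))
    where
    moved : ∀ {W c c′} → c ⊕ t ≡ c′ → c′ ∈ map (_⊕ t) W ⇔ c ∈ W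
    moved refl = ∈-map-⊕ t
  preimage : ∀ {x} → SymDiff (map (_⊕ t) X) (map (_⊕ t) Y) x → ∃[ q ] (x ≡ q ⊕ t)
  preimage (inj₁ (x∈ , _)) = let q , _ , eq = ∈-map⁻ (_⊕ t) x∈ in q , eq
  preimage (inj₂ (x∈ , _)) = let q , _ , eq = ∈-map⁻ (_⊕ t) x∈ in q , eq

-- Moves inside x ≥ 0: shifted ten columns to the right they cannot touch Δ₇.
_⟶₊_ : List Point → List Point → Set
X ⟶₊ Y = Move X Y × ⟦ X ⟧ ⊆ NonNeg × ⟦ Y ⟧ ⊆ NonNeg

⟶₊-shift-behind : ∀ {Z X Y} → ⟦ Z ⟧ ⊆ ⟦ Δ₇ ⟧ → X ⟶₊ Y → (Z ++ map shift X) ⟶₊ (Z ++ map shift Y)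
⟶₊-shift-behind {Z} Z⊆Δ₇ (mv@(v , _ , _ , a , _ , _ , va , _ , sd) , X≥0 , Y≥0) =
  Move-frameˡ (Move-⊕ e₁₀ mv)
    (λ vc c∈Z → Δ₇-Far-separated (v ⊕ e₁₀) vc (InTri-⊕ e₁₀ {v} va) (Z⊆Δ₇ c∈Z) (shift-Far {a} a≥0)) ,
  behind X≥0 , behind Y≥0
  where
  a≥0 : NonNeg a
  a≥0 = Sum.[ X≥0 ∘ proj₁ , Y≥0 ∘ proj₁ ]′ (from (sd a) (inj₁ refl))
  behind : ∀ {W} → ⟦ W ⟧ ⊆ NonNeg → ⟦ Z ++ map shift W ⟧ ⊆ NonNeg
  behind W≥0 x∈ = case ∈-++⁻ Z x∈ of λ where
    (inj₁ x∈Z)   → Δ₇⇒NonNeg (Z⊆Δ₇ x∈Z)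
    (inj₂ x∈W′) → case ∈-map⁻ shift x∈W′ of λ where
      (q , q∈ , refl) → Far⇒NonNeg {shift q} (shift-Far {q} (W≥0 q∈))

-- G fills Δ₇ and none of its points can be dropped; the move in the triangle at (0 , 5) turns
-- it into H; B, which is H without W = {(0 , 6)}, still fills Δ₇.
core G H B W : List Point
core = pt 0 0 ∷ pt 0 1 ∷ pt 2 1 ∷ pt 2 3 ∷ pt 3 0 ∷ pt 3 3 ∷ []
G    = pt 0 5 ∷ pt 0 6 ∷ core
H    = pt 1 5 ∷ pt 0 6 ∷ core
B    = pt 1 5 ∷ core
W    = pt 0 6 ∷ []

elementary-move : Move (pt 0 5 ∷ pt 0 6 ∷ []) (pt 1 5 ∷ pt 0 6 ∷ [])
elementary-move = pt 0 5 , refl , refl , pt 0 5 , pt 1 5 , (λ ()) , inj₁ refl , inj₂ (inj₁ refl) , λ x →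
  mk⇔ (λ where
         (inj₁ (here refl , _))                  → inj₁ refl
         (inj₂ (here refl , _))                  → inj₂ refl
         (inj₁ (there (here refl) , x∉))         → ⊥-elim (x∉ (there (here refl)))
         (inj₂ (there (here refl) , x∉))         → ⊥-elim (x∉ (there (here refl))))
      (λ where
         (inj₁ refl) → inj₁ (here refl , λ { (here ()) ; (there (here ())) })
         (inj₂ refl) → inj₂ (here refl , λ { (here ()) ; (there (here ())) }))

InTri⇒∈corners : ∀ {v c} → InTri v c → c ∈ corners v
InTri⇒∈corners (inj₁ refl)        = here refl
InTri⇒∈corners (inj₂ (inj₁ refl)) = there (here refl)
InTri⇒∈corners (inj₂ (inj₂ refl)) = there (there (here refl))

G⟶₊H : ∀ {T} → ⟦ T ⟧ ⊆ Far → (G ++ T) ⟶₊ (H ++ T)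
G⟶₊H {T} T-far = Move-frameʳ elementary-move avoids , nonneg G-in , nonneg H-in
  where
  outside-core : All (λ c → c ∈ Δ₇ × c ∉ core) (corners (pt 0 5))
  outside-core = from-yes (all? (λ c → c ∈? Δ₇ ×-dec ¬? (c ∈? core)) (corners (pt 0 5)))
  avoids : ∀ {c} → InTri (pt 0 5) c → c ∉ core ++ T
  avoids vc c∈ = let c∈Δ₇ , c∉core = All.lookup outside-core (InTri⇒∈corners {pt 0 5} vc) in
    Sum.[ c∉core , (λ c∈T → Δ₇∩Far-empty c∈Δ₇ (T-far c∈T)) ]′ (∈-++⁻ core c∈)
  G-in : All (_∈ Δ₇) G
  G-in = from-yes (all? (_∈? Δ₇) G)
  H-in : All (_∈ Δ₇) H
  H-in = from-yes (all? (_∈? Δ₇) H)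
  nonneg : ∀ {X} → All (_∈ Δ₇) X → ⟦ X ++ T ⟧ ⊆ NonNeg
  nonneg {X} X-in {x} x∈ = Sum.[ Δ₇⇒NonNeg ∘ All.lookup X-in , Far⇒NonNeg {x} ∘ T-far ]′ (∈-++⁻ X x∈)

copies-orbit : ⟦ G ⟧ ⊆ ⟦ Δ₇ ⟧ → ⟦ H ⟧ ⊆ ⟦ Δ₇ ⟧ → ∀ m → Star _⟶₊_ (copies G m) (copies H m)
copies-orbit G⊆Δ₇ H⊆Δ₇ zero    = ε
copies-orbit G⊆Δ₇ H⊆Δ₇ (suc m) =
  gmap (λ X → G ++ map shift X) (⟶₊-shift-behind G⊆Δ₇) (copies-orbit G⊆Δ₇ H⊆Δ₇ m) ◅◅ (G⟶₊H shifted-far ◅ ε)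
  where
  shifted-far : ⟦ map shift (copies H m) ⟧ ⊆ Far
  shifted-far x∈ = case ∈-map⁻ shift x∈ of λ where
    (q , q∈ , refl) → shift-Far {q} (copies-NonNeg H⊆Δ₇ m q∈)

FillsΔ₇ : List Point → Set
FillsΔ₇ X = ⟦ X ⟧ ⊆ ⟦ Δ₇ ⟧ × ⟦ Δ₇ ⟧ ⊆ Fill ⟦ X ⟧

fills-by-closure : ∀ n {X} → All (_∈ closure n X) Δ₇ → ⟦ Δ₇ ⟧ ⊆ Fill ⟦ X ⟧
fills-by-closure n all∈ = closure-sound n ∘ All.lookup all∈

ClosedProper : List Point → Set
ClosedProper K = All (ClosedAt K) (candidates K) × Any (_∉ K) Δ₇

closedProper? : ∀ K → Dec (ClosedProper K)
closedProper? K = all? (closedAt? K) (candidates K) ×-dec Any.any? (λ y → ¬? (y ∈? K)) Δ₇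

indispensable-by-closure : ∀ n {L x} → ClosedProper (closure n (remove (x ∷ []) L)) →
                           Indispensable ⟦ Δ₇ ⟧ ⟦ L ⟧ x
indispensable-by-closure n {L} {x} (K-closed , y∉K) =
  let y , y∈Δ₇ , y∉ = find y∉K in
  y , y∈Δ₇ , y∉ ∘ Fill-least (closed-by-candidates K-closed)
                   (λ (z∈L , z≢x) → closure-⊇ n (∈-filter⁺ (λ z → ¬? (z ∈? x ∷ [])) z∈L
                                                              λ { (here z≡x) → z≢x z≡x }))

maximal-by-closure :
  ∀ n {P Q} → ⟦ P ⟧ ⊆ ⟦ Δ₇ ⟧ → Unique Q → All (_∈ P) Q → All (_∈ closure n (remove Q P)) Δ₇ →
  All (λ x → ClosedProper (closure n (remove (x ∷ []) (remove Q P)))) (remove Q P) → MaximalExcessSet P Q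
maximal-by-closure n {P} {Q} P⊆Δ₇ Q-unique Q⊆P fills indispensable =
  maximal-by-generation P⊆Δ₇ Q-unique Q⊆P (fills-by-closure n {remove Q P} fills)
    λ {x} x∈ → indispensable-by-closure n {remove Q P} {x} (All.lookup indispensable x∈)

P₃ Q₁ Q₂ : List Point
P₃ = pt 1 0 ∷ G
Q₁ = pt 1 0 ∷ []
Q₂ = pt 0 0 ∷ pt 0 1 ∷ []

opaque
  unfolding closure

  G-fills : FillsΔ₇ G
  G-fills = All.lookup (from-yes (all? (_∈? Δ₇) G)) ,
            fills-by-closure 12 {G} (from-yes (all? (_∈? closure 12 G) Δ₇))

  H-fills : FillsΔ₇ H
  H-fills = All.lookup (from-yes (all? (_∈? Δ₇) H)) ,
            fills-by-closure 12 {H} (from-yes (all? (_∈? closure 12 H) Δ₇))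

  B-fills : FillsΔ₇ B
  B-fills = All.lookup (from-yes (all? (_∈? Δ₇) B)) ,
            fills-by-closure 12 {B} (from-yes (all? (_∈? closure 12 B) Δ₇))

  G-indispensable : ∀ {x} → x ∈ G → Indispensable ⟦ Δ₇ ⟧ ⟦ G ⟧ x
  G-indispensable {x} x∈G = indispensable-by-closure 12 {G} {x} (All.lookup certificate x∈G)
    where
    certificate : All (λ x → ClosedProper (closure 12 (remove (x ∷ []) G))) G
    certificate = from-yes (all? (λ x → closedProper? (closure 12 (remove (x ∷ []) G))) G)

  Q₁-maximal : MaximalExcessSet P₃ Q₁
  Q₁-maximal = maximal-by-closure 12 {P₃} {Q₁}
    (All.lookup (from-yes (all? (_∈? Δ₇) P₃))) (from-yes (unique? Q₁)) (from-yes (all? (_∈? P₃) Q₁))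
    (from-yes (all? (_∈? closure 12 (remove Q₁ P₃)) Δ₇))
    (from-yes (all? (λ x → closedProper? (closure 12 (remove (x ∷ []) (remove Q₁ P₃)))) (remove Q₁ P₃)))

  Q₂-maximal : MaximalExcessSet P₃ Q₂
  Q₂-maximal = maximal-by-closure 12 {P₃} {Q₂}
    (All.lookup (from-yes (all? (_∈? Δ₇) P₃))) (from-yes (unique? Q₂)) (from-yes (all? (_∈? P₃) Q₂))
    (from-yes (all? (_∈? closure 12 (remove Q₂ P₃)) Δ₇))
    (from-yes (all? (λ x → closedProper? (closure 12 (remove (x ∷ []) (remove Q₂ P₃)))) (remove Q₂ P₃)))

copies-SameFill : ∀ {X Y} → FillsΔ₇ X → FillsΔ₇ Y → ∀ m → SameFill ⟦ copies X m ⟧ ⟦ copies Y m ⟧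
copies-SameFill (X⊆Δ₇ , Δ₇⊆X) (Y⊆Δ₇ , Δ₇⊆Y) m x =
  mk⇔ (copies⊆Fill Δ₇⊆Y m ∘ Fill-copies⊆ X⊆Δ₇ m) (copies⊆Fill Δ₇⊆X m ∘ Fill-copies⊆ Y⊆Δ₇ m)

copies-GeneratorsAtLeast : ∀ {X} → FillsΔ₇ X → ∀ m → GeneratorsAtLeast (copies X m) (m * 7)
copies-GeneratorsAtLeast (X⊆Δ₇ , Δ₇⊆X) m R R≈X =
  copies-generators-≥ m R (λ x∈R → Fill-copies⊆ X⊆Δ₇ m (to (R≈X _) (base x∈R)))
                          (λ x∈ → from (R≈X _) (copies⊆Fill Δ₇⊆X m x∈))

G-copies-maximal : ∀ m → MaximalExcessSet (copies G m) []
G-copies-maximal m = maximal-by-indispensability (ExcessSet-[] _) λ x∈ _ →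
  Indispensable-mono (copies⊆Fill (proj₂ G-fills) m) proj₁
                     (copies-indispensable (proj₁ G-fills) G-indispensable m x∈)

W-excess : ∀ m → ExcessSet (copies H m) (copies W m)
W-excess m = copies-unique W⊆Δ₇ (from-yes (unique? W)) m ,
             All.tabulate (copies-mono (All.lookup (from-yes (all? (_∈? H) W))) m) ,
             λ x → mk⇔ (Fill-mono proj₁)
                       (Fill-mono B′⊆H′∖W′ ∘ copies⊆Fill (proj₂ B-fills) m ∘ Fill-copies⊆ (proj₁ H-fills) m)
  where
  W⊆Δ₇ : ⟦ W ⟧ ⊆ ⟦ Δ₇ ⟧
  W⊆Δ₇ = All.lookup (from-yes (all? (_∈? Δ₇) W))
  B⊆H : ⟦ B ⟧ ⊆ ⟦ H ⟧
  B⊆H = All.lookup (from-yes (all? (_∈? H) B))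
  B∩W=∅ : ∀ {x} → x ∈ B → x ∉ W
  B∩W=∅ = All.lookup (from-yes (all? (λ x → ¬? (x ∈? W)) B))
  B′⊆H′∖W′ : ⟦ copies B m ⟧ ⊆ copies H m ∖ copies W m
  B′⊆H′∖W′ x∈ = copies-mono B⊆H m x∈ , copies-disjoint (proj₁ B-fills) W⊆Δ₇ B∩W=∅ m x∈

phantom-excess : (m : ℕ) → ∃[ P ] (FinPattern P × ∃[ e ] (IsExcess P e × m ≤ e) ×
                 (∀ Q → ExcessSet P Q → Q ≡ []))
phantom-excess m =
  copies G m , copies-unique (proj₁ G-fills) (from-yes (unique? G)) m ,
  m , ((m * 7 , minimal-generators , sym excess≡m) , ℕ.≤-refl) ,
  λ Q → only-[]-if-maximal (G-copies-maximal m)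
  where
  minimal-generators : IsMinGenSize (copies G m) (m * 7)
  minimal-generators =
    (copies B m , copies-unique (proj₁ B-fills) (from-yes (unique? B)) m , length-copies B m ,
     copies-SameFill B-fills G-fills m) ,
    λ R _ → copies-GeneratorsAtLeast G-fills m R
  excess≡m : length (copies G m) ∸ m * 7 ≡ m
  excess≡m = begin
    length (copies G m) ∸ m * 7 ≡⟨ cong (_∸ m * 7) (trans (length-copies G m) (ℕ.*-suc m 7)) ⟩
    m + m * 7 ∸ m * 7           ≡⟨ ℕ.m+n∸n≡m m (m * 7) ⟩
    m                           ∎
    where open ≡-Reasoning

visible-excess-gap : (m : ℕ) → ∃[ P ] ∃[ Q ] (FinPattern P × FinPattern Q × SameOrbit P Q ×
                     ∃[ a ] ∃[ b ] (IsVisibleExcess P a × IsVisibleExcess Q b × m + a ≤ b))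
visible-excess-gap m =
  copies G m , copies H m ,
  copies-unique (proj₁ G-fills) (from-yes (unique? G)) m ,
  copies-unique (proj₁ H-fills) (from-yes (unique? H)) m ,
  Star.map proj₁ (copies-orbit (proj₁ G-fills) (proj₁ H-fills) m) ,
  0 , m , G-visible , H-visible , ℕ.≤-reflexive (ℕ.+-identityʳ m)
  where
  G-visible : IsVisibleExcess (copies G m) 0
  G-visible = ([] , ExcessSet-[] _ , refl) ,
              λ Q Q-excess → ℕ.≤-reflexive (cong length (only-[]-if-maximal (G-copies-maximal m) Q-excess))
  H-visible : IsVisibleExcess (copies H m) m
  H-visible = (copies W m , W-excess m , trans (length-copies W m) (ℕ.*-identityʳ m)) ,
              λ Q Q-excess → ℕ.+-cancelʳ-≤ (m * 7) (length Q) m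
                (subst (length Q + m * 7 ≤_) (trans (length-copies H m) (ℕ.*-suc m 7))
                  (ExcessSet-length (copies-GeneratorsAtLeast H-fills m) Q-excess))

maximal-excess-sets-of-different-sizes :
  ∃[ P ] ∃[ Q₁ ] ∃[ Q₂ ] (FinPattern P × MaximalExcessSet P Q₁ × MaximalExcessSet P Q₂ ×
                          length Q₁ ≢ length Q₂)
maximal-excess-sets-of-different-sizes =
  P₃ , Q₁ , Q₂ , from-yes (unique? P₃) , Q₁-maximal , Q₂-maximal , λ ()

theorem4 :
  ((m : ℕ) → ∃[ P ] (FinPattern P × ∃[ e ] (IsExcess P e × m ≤ e) ×
     (∀ Q → ExcessSet P Q → Q ≡ [])))
  × ((m : ℕ) → ∃[ P ] ∃[ Q ] (FinPattern P × FinPattern Q × SameOrbit P Q ×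
     ∃[ a ] ∃[ b ] (IsVisibleExcess P a × IsVisibleExcess Q b × m + a ≤ b)))
  × (∃[ P ] ∃[ Q₁ ] ∃[ Q₂ ] (FinPattern P × MaximalExcessSet P Q₁ ×
     MaximalExcessSet P Q₂ × length Q₁ ≢ length Q₂))
theorem4 = phantom-excess , visible-excess-gap , maximal-excess-sets-of-different-sizes
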